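{- Let $G$ be a classical graph with vertex set $[n]$ and let $f\colon [n] \to \mathbb{C}^d$ be an orthogonal representation of $G$. Then the completely positive map $\phi\colon M_n \to M_d$ defined by $\phi(X) = \sum_{i=1}^n \ket{f(i)}\bra{e_i} X \ket{e_i}\bra{f(i)}$ for all $X\in M_n$ is an orthogonal representation of the quantum graph $\mathcal{S}_G=\operatorname{span}\{ \ket{e_i}\bra{e_j} : i=j \text{ or } i \text{ is adjacent to } j\}$.
   Context: $M_n$ denotes the $n\times n$ complex matrices, $(\ket{e_k})$ the standard basis of $\mathbb{C}^n$. An orthogonal representation of a classical graph $G$ on $[n]$ is a map $f\colon[n]\to\mathbb{C}^d$ such that $f(i)\perp f(j)$ whenever $i\neq j$ and $i,j$ are not adjacent. A quantum graph is a subspace $\mathcal{S}\subseteq M_n$ closed under adjoints and containing the identity. Matrices $a,b$ are orthogonal, $a\perp b$, if $ab=ba=a^*b=ab^*=0$. A completely positive map $\phi\colon M_n\to M_d$ is an orthogonal representation of a quantum graph $\mathcal{S}\subseteq M_n$ if $\phi(A)\perp\phi(B)$ for all $A,B\in M_n$ with $A\mathcal{S}B=B\mathcal{S}A=A^*\mathcal{S}B=A\mathcal{S}B^*=\{0\}$ (where $A\mathcal{S}B=\{AXB : X\in\mathcal{S}\}$). -}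

module Defs where

open import Level using (Level; _⊔_) renaming (suc to lsuc)
open import Data.Nat using (ℕ; zero; suc)
open import Data.Fin using (Fin; zero; suc)
open import Data.Product using (Σ; ∃; _×_; _,_)
open import Data.Sum using (_⊎_)
open import Relation.Nullary using (¬_)
open import Relation.Binary.PropositionalEquality using (_≡_; _≢_)
open import Algebra.Bundles using (CommutativeRing)

-- A field equipped with an involutive field automorphism (conjugation),
-- the abstract setting of which ℂ (with complex conjugation) is the instance.
record StarField (c ℓ : Level) : Set (lsuc (c ⊔ ℓ)) where
  field
    commRing : CommutativeRing c ℓ
  open CommutativeRing commRing public
  field
    0≉1        : ¬ (0# ≈ 1#)
    inverse    : ∀ x → ¬ (x ≈ 0#) → Σ Carrier (λ y → (x * y) ≈ 1#)
    conj       : Carrier → Carrier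
    conj-cong  : ∀ {x y} → x ≈ y → conj x ≈ conj y
    conj-+     : ∀ x y → conj (x + y) ≈ (conj x + conj y)
    conj-*     : ∀ x y → conj (x * y) ≈ (conj x * conj y)
    conj-invol : ∀ x → conj (conj x) ≈ x

record Graph (n : ℕ) : Set₁ where
  field
    Adj    : Fin n → Fin n → Set
    sym    : ∀ {i j} → Adj i j → Adj j i
    irrefl : ∀ {i} → ¬ Adj i i

module _ {c ℓ} (K : StarField c ℓ) where
  open StarField K using (Carrier; _≈_; _+_; _*_; 0#; 1#; conj)

  Vec : ℕ → Set c
  Vec d = Fin d → Carrier

  Mat : ℕ → ℕ → Set c
  Mat m n = Fin m → Fin n → Carrier

  ∑ : ∀ {n} → (Fin n → Carrier) → Carrier
  ∑ {zero}  g = 0#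
  ∑ {suc n} g = g zero + ∑ (λ i → g (suc i))

  ⟨_,_⟩ : ∀ {d} → Vec d → Vec d → Carrier
  ⟨ u , v ⟩ = ∑ (λ k → conj (u k) * v k)

  _≈ᴹ_ : ∀ {m n} → Mat m n → Mat m n → Set ℓ
  A ≈ᴹ B = ∀ i j → A i j ≈ B i j

  0ᴹ : ∀ {m n} → Mat m n
  0ᴹ i j = 0#

  _·_ : ∀ {m k n} → Mat m k → Mat k n → Mat m n
  (A · B) i j = ∑ (λ l → A i l * B l j)

  ∑ᴹ : ∀ {r m n} → (Fin r → Mat m n) → Mat m n
  ∑ᴹ F i j = ∑ (λ t → F t i j)

  _* : ∀ {m n} → Mat m n → Mat n m
  (A *) i j = conj (A j i)

  ket : ∀ {d} → Vec d → Mat d 1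
  ket v i _ = v i

  bra : ∀ {d} → Vec d → Mat 1 d
  bra v = (ket v) *

  e : ∀ {n} → Fin n → Vec n
  e i j with i Data.Fin.≟ j
  ... | Relation.Nullary.yes _ = 1#
  ... | Relation.Nullary.no  _ = 0#

  IsOrthRep : ∀ {n d} → Graph n → (Fin n → Vec d) → Set ℓ
  IsOrthRep {n} G f =
    ∀ (i j : Fin n) → i ≢ j → ¬ Graph.Adj G i j → ⟨ f i , f j ⟩ ≈ 0#

  -- S_G = span{ |e_i⟩⟨e_j| : i = j or i ~ j }, as a membership predicate:
  -- X ∈ S_G iff X is a K-linear combination of the allowed matrix units.
  InSG : ∀ {n} → Graph n → Mat n n → Set (c ⊔ ℓ)
  InSG {n} G X =
    Σ (Fin n → Fin n → Carrier) λ coef →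
      (∀ i j → ¬ (i ≡ j ⊎ Graph.Adj G i j) → coef i j ≈ 0#) ×
      (X ≈ᴹ ∑ᴹ (λ i → ∑ᴹ (λ j → λ a b → coef i j * (ket (e i) · bra (e j)) a b)))

  _⟪_⟫_ : ∀ {n} → Mat n n → (Mat n n → Set (c ⊔ ℓ)) → Mat n n → Set (c ⊔ ℓ)
  A ⟪ S ⟫ B = ∀ X → S X → (A · (X · B)) ≈ᴹ 0ᴹ

  _⊥_ : ∀ {d} → Mat d d → Mat d d → Set ℓ
  a ⊥ b = ((a · b) ≈ᴹ 0ᴹ) × ((b · a) ≈ᴹ 0ᴹ) × (((a *) · b) ≈ᴹ 0ᴹ) × ((a · (b *)) ≈ᴹ 0ᴹ)

  IsQOrthRep : ∀ {n d} → (Mat n n → Set (c ⊔ ℓ)) → (Mat n n → Mat d d) → Set (c ⊔ ℓ)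
  IsQOrthRep {n} S φ =
    ∀ (A B : Mat n n) →
      A ⟪ S ⟫ B → B ⟪ S ⟫ A → (A *) ⟪ S ⟫ B → A ⟪ S ⟫ (B *) →
      φ A ⊥ φ B

  φ : ∀ {n d} → (Fin n → Vec d) → Mat n n → Mat d d
  φ f X = ∑ᴹ (λ i → (ket (f i) · bra (e i)) · (X · (ket (e i) · bra (f i))))

{-# OPTIONS --safe #-}
module Submission where

-- φ(X) = Σᵢ Xᵢᵢ |f i⟩⟨f i| only sees the diagonal of X, so φ(A)* = φ(A*) and
-- φ(A) φ(B) = Σᵢⱼ Aᵢᵢ ⟨f i, f j⟩ Bⱼⱼ |f i⟩⟨f j|.  Each coefficient vanishes when
-- A S_G B = 0: the matrix ⟨f i, f j⟩ |e i⟩⟨e j| lies in S_G (for distinct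
-- non-adjacent i, j the coefficient is 0 because f is an orthogonal
-- representation), and its sandwich between A and B has (i, j) entry
-- Aᵢᵢ ⟨f i, f j⟩ Bⱼⱼ.

open import Defs as D using (StarField; Graph; Vec; IsOrthRep; InSG; IsQOrthRep; φ)
open import Level using (_⊔_)
open import Data.Nat using (ℕ; zero; suc)
open import Data.Fin using (Fin; zero; suc; _≟_)
open import Data.Product using (_,_)
open import Data.Sum using (_⊎_; inj₁; inj₂)
open import Function using (_∘_)
open import Relation.Nullary using (¬_; yes; no; contradiction)
open import Relation.Binary.PropositionalEquality as ≡ using (_≡_; _≢_)

module Matrices {c ℓ} (K : StarField c ℓ) where
  open StarField K hiding (zero)
  open import Algebra.Properties.Semiring.Sum semiring
    using (sum; sum-cong-≋; sum-cong-≗; sum-replicate-zero; *-distribˡ-sum)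
    renaming (∑-comm to sum-comm)
  open import Algebra.Properties.Group +-group using (identityˡ-unique)
  open import Algebra.Properties.CommutativeSemigroup *-commutativeSemigroup
    using (x∙yz≈y∙xz; x∙yz≈z∙yx)
  open import Algebra.Solver.CommutativeMonoid *-commutativeMonoid using (solve; _⊕_; _⊜_)
  open import Relation.Binary.Reasoning.Setoid setoid

  Mat : ℕ → ℕ → Set c
  Mat = D.Mat K

  ∑ : ∀ {n} → (Fin n → Carrier) → Carrier
  ∑ = D.∑ K

  ∑ᴹ : ∀ {r m n} → (Fin r → Mat m n) → Mat m n
  ∑ᴹ = D.∑ᴹ K

  ⟨_,_⟩ : ∀ {d} → Vec K d → Vec K d → Carrier
  ⟨_,_⟩ = D.⟨_,_⟩ K

  _≈ᴹ_ : ∀ {m n} → Mat m n → Mat m n → Set ℓ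
  _≈ᴹ_ = D._≈ᴹ_ K

  0ᴹ : ∀ {m n} → Mat m n
  0ᴹ = D.0ᴹ K

  _·_ : ∀ {m k n} → Mat m k → Mat k n → Mat m n
  _·_ = D._·_ K

  _* : ∀ {m n} → Mat m n → Mat n m
  _* = D._* K

  ket : ∀ {d} → Vec K d → Mat d 1
  ket = D.ket K

  bra : ∀ {d} → Vec K d → Mat 1 d
  bra = D.bra K

  e : ∀ {n} → Fin n → Vec K n
  e = D.e K

  _⟪_⟫_ : ∀ {n} → Mat n n → (Mat n n → Set (c ⊔ ℓ)) → Mat n n → Set (c ⊔ ℓ)
  _⟪_⟫_ = D._⟪_⟫_ K

  ∑≡sum : ∀ {n} (g : Fin n → Carrier) → ∑ g ≡ sum g
  ∑≡sum {zero}  g = ≡.refl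
  ∑≡sum {suc n} g = ≡.cong (g zero +_) (∑≡sum (g ∘ suc))

  ∑-cong : ∀ {n} {g h : Fin n → Carrier} → (∀ i → g i ≈ h i) → ∑ g ≈ ∑ h
  ∑-cong {g = g} {h} g≈h = begin
    ∑ g   ≡⟨ ∑≡sum g ⟩
    sum g ≈⟨ sum-cong-≋ g≈h ⟩
    sum h ≡⟨ ∑≡sum h ⟨
    ∑ h   ∎

  ∑-zero : ∀ {n} {g : Fin n → Carrier} → (∀ i → g i ≈ 0#) → ∑ g ≈ 0#
  ∑-zero {n} {g} g≈0 = begin
    ∑ g                 ≡⟨ ∑≡sum g ⟩
    sum g               ≈⟨ sum-cong-≋ g≈0 ⟩
    sum {n} (λ _ → 0#)  ≈⟨ sum-replicate-zero n ⟩
    0#                  ∎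

  *-distribˡ-∑ : ∀ {n} x (g : Fin n → Carrier) → x * ∑ g ≈ ∑ (λ i → x * g i)
  *-distribˡ-∑ x g = begin
    x * ∑ g                ≡⟨ ≡.cong (x *_) (∑≡sum g) ⟩
    x * sum g              ≈⟨ *-distribˡ-sum x g ⟩
    sum (λ i → x * g i)    ≡⟨ ∑≡sum (λ i → x * g i) ⟨
    ∑ (λ i → x * g i)      ∎

  *-distribʳ-∑ : ∀ {n} x (g : Fin n → Carrier) → ∑ g * x ≈ ∑ (λ i → g i * x)
  *-distribʳ-∑ x g = begin
    ∑ g * x              ≈⟨ *-comm _ x ⟩
    x * ∑ g              ≈⟨ *-distribˡ-∑ x g ⟩
    ∑ (λ i → x * g i)    ≈⟨ ∑-cong (λ i → *-comm x (g i)) ⟩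
    ∑ (λ i → g i * x)    ∎

  ∑-comm : ∀ {m n} (g : Fin m → Fin n → Carrier) →
           ∑ (λ i → ∑ (g i)) ≈ ∑ (λ j → ∑ (λ i → g i j))
  ∑-comm g = begin
    ∑ (λ i → ∑ (g i))               ≡⟨ ∑∑≡sumsum g ⟩
    sum (λ i → sum (g i))           ≈⟨ sum-comm g ⟩
    sum (λ j → sum (λ i → g i j))   ≡⟨ ∑∑≡sumsum (λ j i → g i j) ⟨
    ∑ (λ j → ∑ (λ i → g i j))       ∎
    where
    ∑∑≡sumsum : ∀ {m n} (h : Fin m → Fin n → Carrier) →
                ∑ (λ i → ∑ (h i)) ≡ sum (λ i → sum (h i))
    ∑∑≡sumsum h = ≡.trans (∑≡sum (λ i → ∑ (h i))) (sum-cong-≗ (λ i → ∑≡sum (h i)))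

  conj-0# : conj 0# ≈ 0#
  conj-0# = identityˡ-unique (conj 0#) (conj 0#) (begin
    conj 0# + conj 0#  ≈⟨ conj-+ 0# 0# ⟨
    conj (0# + 0#)     ≈⟨ conj-cong (+-identityˡ 0#) ⟩
    conj 0#            ∎)

  conj-1# : conj 1# ≈ 1#
  conj-1# = begin
    u              ≈⟨ *-identityʳ u ⟨
    u * 1#         ≈⟨ *-congˡ (conj-invol 1#) ⟨
    u * conj u     ≈⟨ conj-* 1# u ⟨
    conj (1# * u)  ≈⟨ conj-cong (*-identityˡ u) ⟩
    conj u         ≈⟨ conj-invol 1# ⟩
    1#             ∎
    where u = conj 1#

  conj-∑ : ∀ {n} (g : Fin n → Carrier) → conj (∑ g) ≈ ∑ (conj ∘ g)
  conj-∑ {zero}  g = conj-0#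
  conj-∑ {suc n} g = trans (conj-+ _ _) (+-congˡ (conj-∑ (g ∘ suc)))

  e-diag : ∀ {n} (i : Fin n) → e i i ≈ 1#
  e-diag i with i ≟ i
  ... | yes _   = refl
  ... | no  i≢i = contradiction ≡.refl i≢i

  e-offdiag : ∀ {n} {i j : Fin n} → i ≢ j → e i j ≈ 0#
  e-offdiag {i = i} {j} i≢j with i ≟ j
  ... | yes i≡j = contradiction i≡j i≢j
  ... | no _    = refl

  e-suc : ∀ {n} (i j : Fin n) → e (suc i) (suc j) ≈ e i j
  e-suc i j with i ≟ j
  ... | yes _ = refl
  ... | no _  = refl

  -- Only e i j is abstracted over i ≟ j; e j i still has to be evaluated.
  e-sym : ∀ {n} (i j : Fin n) → e i j ≈ e j i
  e-sym i j with i ≟ j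
  ... | yes ≡.refl = sym (e-diag i)
  ... | no i≢j     = sym (e-offdiag (i≢j ∘ ≡.sym))

  conj-e : ∀ {n} (i j : Fin n) → conj (e i j) ≈ e i j
  conj-e i j with i ≟ j
  ... | yes _ = conj-1#
  ... | no _  = conj-0#

  ∑-e : ∀ {n} (i : Fin n) (g : Fin n → Carrier) → ∑ (λ k → e i k * g k) ≈ g i
  ∑-e zero g = begin
    1# * g zero + ∑ (λ k → 0# * g (suc k))
      ≈⟨ +-cong (*-identityˡ (g zero)) (∑-zero (λ k → zeroˡ (g (suc k)))) ⟩
    g zero + 0#
      ≈⟨ +-identityʳ (g zero) ⟩
    g zero ∎
  ∑-e (suc i) g = begin
    0# * g zero + ∑ (λ k → e (suc i) (suc k) * g (suc k))
      ≈⟨ +-cong (zeroˡ (g zero)) (∑-cong (λ k → *-congʳ (e-suc i k))) ⟩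
    0# + ∑ (λ k → e i k * g (suc k))
      ≈⟨ +-identityˡ _ ⟩
    ∑ (λ k → e i k * g (suc k))
      ≈⟨ ∑-e i (g ∘ suc) ⟩
    g (suc i) ∎

  ∑-e′ : ∀ {n} (i : Fin n) (g : Fin n → Carrier) → ∑ (λ k → e k i * g k) ≈ g i
  ∑-e′ i g = trans (∑-cong (λ k → *-congʳ (e-sym k i))) (∑-e i g)

  ≈ᴹ-refl : ∀ {m n} {A : Mat m n} → A ≈ᴹ A
  ≈ᴹ-refl i j = refl

  ≈ᴹ-trans : ∀ {m n} {A B C : Mat m n} → A ≈ᴹ B → B ≈ᴹ C → A ≈ᴹ C
  ≈ᴹ-trans A≈B B≈C i j = trans (A≈B i j) (B≈C i j)

  ·-cong : ∀ {m k n} {A A′ : Mat m k} {B B′ : Mat k n} →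
           A ≈ᴹ A′ → B ≈ᴹ B′ → (A · B) ≈ᴹ (A′ · B′)
  ·-cong A≈A′ B≈B′ i j = ∑-cong (λ l → *-cong (A≈A′ i l) (B≈B′ l j))

  ket-bra : ∀ {m n} (u : Vec K m) (v : Vec K n) a b → (ket u · bra v) a b ≈ u a * conj (v b)
  ket-bra u v a b = +-identityʳ _

  unit-entry : ∀ {n} (i j p q : Fin n) → (ket (e i) · bra (e j)) p q ≈ e i p * e j q
  unit-entry i j p q = trans (ket-bra (e i) (e j) p q) (*-congˡ (conj-e j q))

  unit-expansion : ∀ {n} (C : Mat n n) →
                   ∑ᴹ (λ i → ∑ᴹ (λ j → λ a b → C i j * (ket (e i) · bra (e j)) a b)) ≈ᴹ C
  unit-expansion C p q = begin
    ∑ (λ i → ∑ (λ j → C i j * (ket (e i) · bra (e j)) p q))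
      ≈⟨ ∑-cong (λ i → ∑-cong (λ j → *-congˡ (unit-entry i j p q))) ⟩
    ∑ (λ i → ∑ (λ j → C i j * (e i p * e j q)))
      ≈⟨ ∑-cong (λ i → ∑-cong (λ j → x∙yz≈z∙yx (C i j) (e i p) (e j q))) ⟩
    ∑ (λ i → ∑ (λ j → e j q * (e i p * C i j)))
      ≈⟨ ∑-cong (λ i → ∑-e′ q (λ j → e i p * C i j)) ⟩
    ∑ (λ i → e i p * C i q)
      ≈⟨ ∑-e′ p (λ i → C i q) ⟩
    C p q ∎

  InSG-supported : ∀ {n} (G : Graph n) (C : Mat n n) →
                   (∀ p q → ¬ (p ≡ q ⊎ Graph.Adj G p q) → C p q ≈ 0#) → InSG K G C
  InSG-supported G C support = C , support , λ p q → sym (unit-expansion C p q)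

  sandwich-unit : ∀ {n} (A B g : Mat n n) (i j k l : Fin n) →
                  (A · ((λ p q → e i p * e j q * g p q) · B)) k l ≈ A k i * g i j * B j l
  sandwich-unit A B g i j k l = begin
    ∑ (λ p → A k p * ∑ (λ q → e i p * e j q * g p q * B q l))
      ≈⟨ ∑-cong (λ p → *-congˡ (row p)) ⟩
    ∑ (λ p → A k p * (e i p * (g p j * B j l)))
      ≈⟨ ∑-cong (λ p → x∙yz≈y∙xz (A k p) (e i p) (g p j * B j l)) ⟩
    ∑ (λ p → e i p * (A k p * (g p j * B j l)))
      ≈⟨ ∑-e i (λ p → A k p * (g p j * B j l)) ⟩
    A k i * (g i j * B j l)
      ≈⟨ *-assoc (A k i) (g i j) (B j l) ⟨
    A k i * g i j * B j l ∎
    where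
    row : ∀ p → ∑ (λ q → e i p * e j q * g p q * B q l) ≈ e i p * (g p j * B j l)
    row p = trans
      (∑-cong (λ q → solve 4 (λ a b x y → ((a ⊕ b) ⊕ x) ⊕ y ⊜ b ⊕ (a ⊕ (x ⊕ y))) refl
                       (e i p) (e j q) (g p q) (B q l)))
      (∑-e j (λ q → e i p * (g p q * B q l)))

  rankOneSum : ∀ {n d} → (Fin n → Vec K d) → (Fin n → Carrier) → Mat d d
  rankOneSum f α a b = ∑ (λ i → α i * (f i a * conj (f i b)))

  ket-bra-sandwich : ∀ {n d} (u v : Vec K d) (i : Fin n) (X : Mat n n) a b →
                     ((ket u · bra (e i)) · (X · (ket (e i) · bra v))) a b
                       ≈ X i i * (u a * conj (v b))
  ket-bra-sandwich u v i X a b = begin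
    ∑ (λ l → (ket u · bra (e i)) a l * ∑ (λ m → X l m * (ket (e i) · bra v) m b))
      ≈⟨ ∑-cong (λ l → *-cong (trans (ket-bra u (e i) a l) (*-congˡ (conj-e i l)))
                             (column l)) ⟩
    ∑ (λ l → u a * e i l * (X l i * conj (v b)))
      ≈⟨ ∑-cong (λ l → *-congʳ (*-comm (u a) (e i l))) ⟩
    ∑ (λ l → e i l * u a * (X l i * conj (v b)))
      ≈⟨ ∑-cong (λ l → *-assoc (e i l) (u a) (X l i * conj (v b))) ⟩
    ∑ (λ l → e i l * (u a * (X l i * conj (v b))))
      ≈⟨ ∑-e i (λ l → u a * (X l i * conj (v b))) ⟩
    u a * (X i i * conj (v b))
      ≈⟨ x∙yz≈y∙xz (u a) (X i i) (conj (v b)) ⟩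
    X i i * (u a * conj (v b)) ∎
    where
    column : ∀ l → ∑ (λ m → X l m * (ket (e i) · bra v) m b) ≈ X l i * conj (v b)
    column l = trans
      (∑-cong (λ m → trans (*-congˡ (ket-bra (e i) v m b))
                           (x∙yz≈y∙xz (X l m) (e i m) (conj (v b)))))
      (∑-e i (λ m → X l m * conj (v b)))

  φ-diagonal : ∀ {n d} (f : Fin n → Vec K d) (X : Mat n n) →
               φ K f X ≈ᴹ rankOneSum f (λ i → X i i)
  φ-diagonal f X a b = ∑-cong (λ i → ket-bra-sandwich (f i) (f i) i X a b)

  rankOneSum-adjoint : ∀ {n d} (f : Fin n → Vec K d) (α : Fin n → Carrier) →
                       (rankOneSum f α *) ≈ᴹ rankOneSum f (conj ∘ α)
  rankOneSum-adjoint f α a b = trans (conj-∑ (λ i → α i * (f i b * conj (f i a)))) (∑-cong term)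
    where
    term : ∀ i → conj (α i * (f i b * conj (f i a))) ≈ conj (α i) * (f i a * conj (f i b))
    term i = begin
      conj (α i * (f i b * conj (f i a)))
        ≈⟨ conj-* (α i) _ ⟩
      conj (α i) * conj (f i b * conj (f i a))
        ≈⟨ *-congˡ (conj-* (f i b) _) ⟩
      conj (α i) * (conj (f i b) * conj (conj (f i a)))
        ≈⟨ *-congˡ (*-congˡ (conj-invol (f i a))) ⟩
      conj (α i) * (conj (f i b) * f i a)
        ≈⟨ *-congˡ (*-comm (conj (f i b)) (f i a)) ⟩
      conj (α i) * (f i a * conj (f i b)) ∎

  rankOneSum-product : ∀ {n d} (f : Fin n → Vec K d) (α β : Fin n → Carrier) a b →
    (rankOneSum f α · rankOneSum f β) a b
      ≈ ∑ (λ i → ∑ (λ j → α i * ⟨ f i , f j ⟩ * β j * (f i a * conj (f j b))))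
  rankOneSum-product {n} {d} f α β a b = begin
    ∑ (λ k → ∑ (λ i → P i k) * ∑ (λ j → Q j k))
      ≈⟨ ∑-cong (λ k → trans (*-distribʳ-∑ _ (λ i → P i k))
                             (∑-cong (λ i → *-distribˡ-∑ (P i k) (λ j → Q j k)))) ⟩
    ∑ (λ k → ∑ (λ i → ∑ (λ j → P i k * Q j k)))
      ≈⟨ ∑-comm (λ k i → ∑ (λ j → P i k * Q j k)) ⟩
    ∑ (λ i → ∑ (λ k → ∑ (λ j → P i k * Q j k)))
      ≈⟨ ∑-cong (λ i → ∑-comm (λ k j → P i k * Q j k)) ⟩
    ∑ (λ i → ∑ (λ j → ∑ (λ k → P i k * Q j k)))
      ≈⟨ ∑-cong (λ i → ∑-cong (λ j → pair i j)) ⟩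
    ∑ (λ i → ∑ (λ j → α i * ⟨ f i , f j ⟩ * β j * (f i a * conj (f j b)))) ∎
    where
    P Q : Fin n → Fin d → Carrier
    P i k = α i * (f i a * conj (f i k))
    Q j k = β j * (f j k * conj (f j b))
    pair : ∀ i j → ∑ (λ k → P i k * Q j k) ≈ α i * ⟨ f i , f j ⟩ * β j * (f i a * conj (f j b))
    pair i j = begin
      ∑ (λ k → P i k * Q j k)
        ≈⟨ ∑-cong (λ k → solve 6
             (λ x y p q r s → (x ⊕ (p ⊕ q)) ⊕ (y ⊕ (r ⊕ s)) ⊜ ((x ⊕ y) ⊕ (p ⊕ s)) ⊕ (q ⊕ r)) refl
             (α i) (β j) (f i a) (conj (f i k)) (f j k) (conj (f j b))) ⟩
      ∑ (λ k → α i * β j * (f i a * conj (f j b)) * (conj (f i k) * f j k))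
        ≈⟨ *-distribˡ-∑ (α i * β j * (f i a * conj (f j b))) (λ k → conj (f i k) * f j k) ⟨
      α i * β j * (f i a * conj (f j b)) * (⟨ f i , f j ⟩)
        ≈⟨ solve 4 (λ x y w g → ((x ⊕ y) ⊕ w) ⊕ g ⊜ ((x ⊕ g) ⊕ y) ⊕ w) refl
             (α i) (β j) (f i a * conj (f j b)) (⟨ f i , f j ⟩) ⟩
      α i * (⟨ f i , f j ⟩) * β j * (f i a * conj (f j b)) ∎

  rankOneSum-orthogonal : ∀ {n d} (f : Fin n → Vec K d) (α β : Fin n → Carrier) →
    (∀ i j → α i * ⟨ f i , f j ⟩ * β j ≈ 0#) → (rankOneSum f α · rankOneSum f β) ≈ᴹ 0ᴹ
  rankOneSum-orthogonal f α β αfβ≈0 a b = trans (rankOneSum-product f α β a b)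
    (∑-zero (λ i → ∑-zero (λ j → trans (*-congʳ (αfβ≈0 i j)) (zeroˡ _))))

  diagonal-orthogonal : ∀ {n d} (G : Graph n) (f : Fin n → Vec K d) → IsOrthRep K G f →
    ∀ {A B} → A ⟪ InSG K G ⟫ B → ∀ i j → A i i * ⟨ f i , f j ⟩ * B j j ≈ 0#
  diagonal-orthogonal {n} G f orth {A} {B} ASB i j = begin
    A i i * ⟨ f i , f j ⟩ * B j j  ≈⟨ sandwich-unit A B gram i j i j ⟨
    (A · (X · B)) i j              ≈⟨ ASB X (InSG-supported G X X-supported) i j ⟩
    0#                             ∎
    where
    gram : Mat n n
    gram p q = ⟨ f p , f q ⟩
    -- ⟨f i, f j⟩ |e i⟩⟨e j|, with the coefficient taken at (p, q) so that
    -- orthogonality of f alone bounds its support.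
    X : Mat n n
    X p q = e i p * e j q * gram p q
    X-supported : ∀ p q → ¬ (p ≡ q ⊎ Graph.Adj G p q) → X p q ≈ 0#
    X-supported p q p≁q = trans (*-congˡ (orth p q (p≁q ∘ inj₁) (p≁q ∘ inj₂))) (zeroʳ _)

  φ-adjoint : ∀ {n d} (f : Fin n → Vec K d) (X : Mat n n) → (φ K f X *) ≈ᴹ φ K f (X *)
  φ-adjoint f X a b = begin
    conj (φ K f X b a)                     ≈⟨ conj-cong (φ-diagonal f X b a) ⟩
    (rankOneSum f (λ i → X i i) *) a b     ≈⟨ rankOneSum-adjoint f (λ i → X i i) a b ⟩
    rankOneSum f (λ i → conj (X i i)) a b  ≈⟨ φ-diagonal f (X *) a b ⟨
    φ K f (X *) a b                        ∎

  φ-orthogonal : ∀ {n d} (G : Graph n) (f : Fin n → Vec K d) → IsOrthRep K G f →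
    ∀ {A B} → A ⟪ InSG K G ⟫ B → (φ K f A · φ K f B) ≈ᴹ 0ᴹ
  φ-orthogonal G f orth {A} {B} ASB =
    ≈ᴹ-trans (·-cong (φ-diagonal f A) (φ-diagonal f B))
             (rankOneSum-orthogonal f _ _ (diagonal-orthogonal G f orth ASB))

proposition5p4 : ∀ {c ℓ} (K : StarField c ℓ) {n d : ℕ} (G : Graph n)
    (f : Fin n → Vec K d) →
    IsOrthRep K G f →
    IsQOrthRep K (InSG K G) (φ K f)
proposition5p4 K G f orth A B ASB BSA A*SB ASB* =
    φ-orthogonal G f orth ASB
  , φ-orthogonal G f orth BSA
  , ≈ᴹ-trans (·-cong (φ-adjoint f A) ≈ᴹ-refl) (φ-orthogonal G f orth A*SB)
  , ≈ᴹ-trans (·-cong ≈ᴹ-refl (φ-adjoint f B)) (φ-orthogonal G f orth ASB*)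
  where open Matrices K
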